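{- Let $m\ge3$ and let $\varphi$ be a proper 3-edge-coloring of $G_{\alpha}(m;1,1,1)$, and write $c_j=\varphi(v_jw_j)$ for $j=0,\dots,m-1$. Then there are no indices $0\le i<i+\ell\le m-1$ and distinct colors $x,y,z$ such that either (1) $\ell$ is even with $\ell\ge 2$, $c_i=c_{i+\ell}=x$ and $c_j=y$ for all $i<j<i+\ell$; or (2) $\ell$ is odd with $\ell\ge 3$, $c_i=x$, $c_{i+\ell}=z$ and $c_j=y$ for all $i<j<i+\ell$.
   Context: Let $G$ be the graph with the 11 vertices $A,B,A',B',v,x_1,\dots,x_6$ and the 14 edges $Av,\ vA',\ Ax_6,\ x_6x_2,\ x_6x_5,\ x_2x_4,\ x_2B,\ x_4x_3,\ x_4B',\ x_3A',\ x_3x_5,\ x_5x_1,\ x_1B,\ x_1B'$. For $m\ge3$, $G_{\alpha}(m;1,1,1)$ is the cubic graph with vertex set $\{u_i: u\in V(G),\ i\in\mathbb{Z}_m\}\cup\{w_i: i\in\mathbb{Z}_m\}$ and edges $u_iu'_i$ for every edge $uu'$ of $G$, spoke edges $v_iw_i$, loop edges $w_iw_{i+1}$, and connecting edges $A'_iA_{i+1}$, $B'_iB_{i+1}$ (indices mod $m$). In other words, the sequence of spoke colors $c_0c_1\cdots c_{m-1}$ contains no (non-wrapping) block of the form $x\,y^{n}\,x$ with $n$ odd, nor $x\,y^{n}\,z$ with $n\ge 2$ even. -}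

module Defs where

open import Data.Nat using (ℕ; zero; suc; _+_; _*_)
open import Data.Nat.DivMod using (_mod_)
open import Data.Fin using (Fin; toℕ)
open import Data.Product using (_×_; _,_; proj₁; proj₂; ∃)
open import Data.Sum using (_⊎_)
open import Relation.Binary.PropositionalEquality using (_≡_)

data GV : Set where
  A B A' B' v x1 x2 x3 x4 x5 x6 : GV

data GE : Set where
  Av vA' Ax6 x6x2 x6x5 x2x4 x2B x4x3 x4B' x3A' x3x5 x5x1 x1B x1B' : GE

gEnds : GE → GV × GV
gEnds Av   = A , v
gEnds vA'  = v , A'
gEnds Ax6  = A , x6
gEnds x6x2 = x6 , x2
gEnds x6x5 = x6 , x5
gEnds x2x4 = x2 , x4
gEnds x2B  = x2 , B
gEnds x4x3 = x4 , x3
gEnds x4B' = x4 , B'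
gEnds x3A' = x3 , A'
gEnds x3x5 = x3 , x5
gEnds x5x1 = x5 , x1
gEnds x1B  = x1 , B
gEnds x1B' = x1 , B'

next : ∀ {m} → Fin m → Fin m
next {suc k} i = suc (toℕ i) mod suc k

-- Vertices of G_α(m;1,1,1): u_i for u ∈ V(G), and w_i
data Vtx (m : ℕ) : Set where
  cp : GV → Fin m → Vtx m
  w  : Fin m → Vtx m

data Edge (m : ℕ) : Set where
  copy  : GE → Fin m → Edge m
  spoke : Fin m → Edge m
  loop  : Fin m → Edge m
  connA : Fin m → Edge m
  connB : Fin m → Edge m

ends : ∀ {m} → Edge m → Vtx m × Vtx m
ends (copy e i) = cp (proj₁ (gEnds e)) i , cp (proj₂ (gEnds e)) i
ends (spoke i)  = cp v i , w i
ends (loop i)   = w i , w (next i)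
ends (connA i)  = cp A' i , cp A (next i)
ends (connB i)  = cp B' i , cp B (next i)

Incident : ∀ {m} → Edge m → Vtx m → Set
Incident e x = proj₁ (ends e) ≡ x ⊎ proj₂ (ends e) ≡ x

Coloring : ℕ → Set
Coloring m = Edge m → Fin 3

Proper : ∀ {m} → Coloring m → Set
Proper {m} φ = ∀ (e e' : Edge m) (x : Vtx m) →
  Incident e x → Incident e' x → φ e ≡ φ e' → e ≡ e'

spokeColor : ∀ {m} → Coloring m → Fin m → Fin 3
spokeColor φ j = φ (spoke j)

Even Odd : ℕ → Set
Even n = ∃ λ t → n ≡ t * 2
Odd  n = ∃ λ t → n ≡ suc (t * 2)

-- Only the wheel w₀ w₁ … w_{m-1} with its spokes matters.  At w_{j+1} the
-- edges w_j w_{j+1}, w_{j+1} w_{j+2} and the spoke at w_{j+1} get three different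
-- colours, so along a run of spokes coloured y the rim edges alternate between
-- the two other colours.  The rim edge w_i w_{i+1} avoids c_i = x and y, hence is
-- z; then the rim edge entering w_{i+ℓ} is z when ℓ is odd and x when ℓ is even,
-- which is exactly the colour the block forces on the spoke c_{i+ℓ}.
module Submission where

open import Defs
open import Data.Nat using (ℕ; zero; suc; _+_; _*_; _≤_; _<_; s≤s; z≤n)
open import Data.Nat.Properties using (+-suc; +-identityʳ; +-monoʳ-≤; +-monoʳ-<; m<m+n; ≤-trans; <-trans; n<1+n; n≤1+n; 1+n≢n)
open import Data.Nat.DivMod using (_mod_; m<n⇒m%n≡m)
open import Data.Fin using (Fin; toℕ)
open import Data.Fin.Patterns using (0F; 1F; 2F)
open import Data.Fin.Properties using (toℕ-fromℕ<; toℕ-injective; toℕ<n)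
open import Data.Empty using (⊥-elim)
open import Data.Product using (_×_; Σ; _,_)
open import Data.Sum using (_⊎_; inj₁; inj₂)
open import Function using (_∘_)
open import Relation.Binary.PropositionalEquality using (_≡_; _≢_; refl; sym; trans; cong; subst; subst₂)
open import Relation.Nullary using (¬_)

third : Fin 3 → Fin 3 → Fin 3
third 0F 1F = 2F
third 1F 0F = 2F
third 0F 2F = 1F
third 2F 0F = 1F
third 1F 2F = 0F
third 2F 1F = 0F
third a  _  = a

≡third : ∀ {a b c : Fin 3} → a ≢ b → c ≢ a → c ≢ b → c ≡ third a b
≡third {0F} {0F}      a≢b _   _   = ⊥-elim (a≢b refl)
≡third {1F} {1F}      a≢b _   _   = ⊥-elim (a≢b refl)
≡third {2F} {2F}      a≢b _   _   = ⊥-elim (a≢b refl)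
≡third {0F} {_}  {0F} _   c≢a _   = ⊥-elim (c≢a refl)
≡third {1F} {_}  {1F} _   c≢a _   = ⊥-elim (c≢a refl)
≡third {2F} {_}  {2F} _   c≢a _   = ⊥-elim (c≢a refl)
≡third {_}  {0F} {0F} _   _   c≢b = ⊥-elim (c≢b refl)
≡third {_}  {1F} {1F} _   _   c≢b = ⊥-elim (c≢b refl)
≡third {_}  {2F} {2F} _   _   c≢b = ⊥-elim (c≢b refl)
≡third {0F} {1F} {2F} _   _   _   = refl
≡third {0F} {2F} {1F} _   _   _   = refl
≡third {1F} {0F} {2F} _   _   _   = refl
≡third {1F} {2F} {0F} _   _   _   = refl
≡third {2F} {0F} {1F} _   _   _   = refl
≡third {2F} {1F} {0F} _   _   _   = refl

≢-≢⇒≡ : ∀ {a b c d : Fin 3} → a ≢ b → c ≢ a → c ≢ b → d ≢ a → d ≢ b → c ≡ d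
≢-≢⇒≡ a≢b c≢a c≢b d≢a d≢b = trans (≡third a≢b c≢a c≢b) (sym (≡third a≢b d≢a d≢b))

module Alternation
  (r c : ℕ → Fin 3) {ℓ : ℕ} (2≤ℓ : 2 ≤ ℓ)
  (r≢c : ∀ {t} → t < ℓ → r t ≢ c t)
  (r≢c-suc : ∀ {t} → t < ℓ → r t ≢ c (suc t))
  (r≢r-suc : ∀ {t} → suc t < ℓ → r t ≢ r (suc t))
  {x y z : Fin 3} (x≢y : x ≢ y) (y≢z : y ≢ z) (x≢z : x ≢ z)
  (c₀≡x : c 0 ≡ x) (c≡y : ∀ {t} → 0 < t → t < ℓ → c t ≡ y)
  where

  r₀≡z : r 0 ≡ z
  r₀≡z = ≢-≢⇒≡ x≢y (λ r₀≡x → r≢c 0<ℓ (trans r₀≡x (sym c₀≡x)))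
                   (λ r₀≡y → r≢c-suc 0<ℓ (trans r₀≡y (sym (c≡y (s≤s z≤n) 2≤ℓ))))
                   (x≢z ∘ sym) (y≢z ∘ sym)
    where 0<ℓ = ≤-trans (n≤1+n 1) 2≤ℓ

  r-suc : ∀ {t a b} → suc t < ℓ → a ≢ y → b ≢ y → a ≢ b → r t ≡ a → r (suc t) ≡ b
  r-suc {t} t+1<ℓ a≢y b≢y a≢b rₜ≡a =
    ≢-≢⇒≡ a≢y (λ eq → r≢r-suc t+1<ℓ (trans rₜ≡a (sym eq)))
              (λ eq → r≢c t+1<ℓ (trans eq (sym (c≡y (s≤s z≤n) t+1<ℓ))))
              (a≢b ∘ sym) b≢y

  r-even : ∀ d → d * 2 < ℓ → r (d * 2) ≡ z
  r-odd  : ∀ d → suc (d * 2) < ℓ → r (suc (d * 2)) ≡ x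
  r-even zero    _   = r₀≡z
  r-even (suc d) lt  = r-suc lt x≢y (y≢z ∘ sym) x≢z (r-odd d (<-trans (n<1+n _) lt))
  r-odd  d       lt  = r-suc lt (y≢z ∘ sym) x≢y (x≢z ∘ sym) (r-even d (<-trans (n<1+n _) lt))

  even-block-impossible : Even ℓ → c ℓ ≢ x
  -- the case ℓ = 0 is absurd by 2≤ℓ
  even-block-impossible (suc d , refl) cℓ≡x =
    r≢c-suc (n<1+n _) (trans (r-odd d (n<1+n _)) (sym cℓ≡x))

  odd-block-impossible : Odd ℓ → c ℓ ≢ z
  odd-block-impossible (d , refl) cℓ≡z =
    r≢c-suc (n<1+n _) (trans (r-even d (n<1+n _)) (sym cℓ≡z))

proper⇒≢ : ∀ {m} {φ : Coloring m} → Proper φ →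
           ∀ {e e'} u → Incident e u → Incident e' u → e ≢ e' → φ e ≢ φ e'
proper⇒≢ proper u e∋u e'∋u e≢e' = e≢e' ∘ proper _ _ u e∋u e'∋u

loop-injective : ∀ {m} {a b : Fin m} → loop a ≡ loop b → a ≡ b
loop-injective refl = refl

module Wheel {k : ℕ} {φ : Coloring (suc k)} (proper : Proper φ) where

  fin : ℕ → Fin (suc k)
  fin n = n mod suc k

  toℕ-fin : ∀ {n} → n < suc k → toℕ (fin n) ≡ n
  toℕ-fin lt = trans (toℕ-fromℕ< _) (m<n⇒m%n≡m lt)

  fin-toℕ : ∀ j → fin (toℕ j) ≡ j
  fin-toℕ j = toℕ-injective (toℕ-fin (toℕ<n j))

  fin-injective : ∀ {n n'} → n < suc k → n' < suc k → fin n ≡ fin n' → n ≡ n'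
  fin-injective lt lt' eq = trans (sym (toℕ-fin lt)) (trans (cong toℕ eq) (toℕ-fin lt'))

  next-fin : ∀ {n} → suc n < suc k → next (fin n) ≡ fin (suc n)
  next-fin {n} lt rewrite toℕ-fin (<-trans (n<1+n n) lt) = refl

  rim spokes : ℕ → Fin 3
  rim    n = φ (loop (fin n))
  spokes n = φ (spoke (fin n))

  rim≢spokes : ∀ n → rim n ≢ spokes n
  rim≢spokes n = proper⇒≢ proper (w (fin n)) (inj₁ refl) (inj₂ refl) λ ()

  rim≢spokes-suc : ∀ {n} → suc n < suc k → rim n ≢ spokes (suc n)
  rim≢spokes-suc {n} lt =
    proper⇒≢ proper (w (fin (suc n))) (inj₂ (cong w (next-fin lt))) (inj₂ refl) λ ()

  rim≢rim-suc : ∀ {n} → suc n < suc k → rim n ≢ rim (suc n)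
  rim≢rim-suc {n} lt =
    proper⇒≢ proper (w (fin (suc n))) (inj₂ (cong w (next-fin lt))) (inj₁ refl)
      (1+n≢n ∘ fin-injective lt (<-trans (n<1+n n) lt) ∘ sym ∘ loop-injective)

  module Window (i : Fin (suc k)) {ℓ : ℕ} (i+ℓ<m : toℕ i + ℓ < suc k) where

    r c : ℕ → Fin 3
    r t = rim    (toℕ i + t)
    c t = spokes (toℕ i + t)

    suc-i+t<m : ∀ {t} → t < ℓ → suc (toℕ i + t) < suc k
    suc-i+t<m {t} t<ℓ =
      subst (λ n → suc n ≤ suc k) (+-suc (toℕ i) t) (≤-trans (s≤s (+-monoʳ-≤ (toℕ i) t<ℓ)) i+ℓ<m)

    r≢c : ∀ {t} → t < ℓ → r t ≢ c t
    r≢c {t} _ = rim≢spokes (toℕ i + t)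

    r≢c-suc : ∀ {t} → t < ℓ → r t ≢ c (suc t)
    r≢c-suc {t} t<ℓ eq = rim≢spokes-suc (suc-i+t<m t<ℓ) (trans eq (cong spokes (+-suc (toℕ i) t)))

    r≢r-suc : ∀ {t} → suc t < ℓ → r t ≢ r (suc t)
    r≢r-suc {t} t+1<ℓ eq =
      rim≢rim-suc (suc-i+t<m (<-trans (n<1+n t) t+1<ℓ)) (trans eq (cong rim (+-suc (toℕ i) t)))

    c≡spokeColor : ∀ {t} (j : Fin (suc k)) → toℕ j ≡ toℕ i + t → c t ≡ spokeColor φ j
    c≡spokeColor j j≡i+t = trans (cong spokes (sym j≡i+t)) (cong (φ ∘ spoke) (fin-toℕ j))

    c≡inner : ∀ {j : Fin (suc k)} {y} → toℕ j ≡ toℕ i + ℓ →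
              (∀ (j' : Fin (suc k)) → toℕ i < toℕ j' → toℕ j' < toℕ j → spokeColor φ j' ≡ y) →
              ∀ {t} → 0 < t → t < ℓ → c t ≡ y
    c≡inner {j} j≡i+ℓ inner {t} 0<t t<ℓ =
      trans (c≡spokeColor (fin (toℕ i + t)) (sym i+t≡j'))
            (inner _ (subst (toℕ i <_) i+t≡j' (m<m+n (toℕ i) 0<t))
                     (subst₂ _<_ i+t≡j' (sym j≡i+ℓ) (+-monoʳ-< (toℕ i) t<ℓ)))
      where
      i+t≡j' : toℕ i + t ≡ toℕ (fin (toℕ i + t))
      i+t≡j' = sym (toℕ-fin (<-trans (n<1+n _) (suc-i+t<m t<ℓ)))

  module Block
    {i j : Fin (suc k)} {ℓ : ℕ} (j≡i+ℓ : toℕ j ≡ toℕ i + ℓ) {y : Fin 3}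
    (inner : ∀ (j' : Fin (suc k)) → toℕ i < toℕ j' → toℕ j' < toℕ j → spokeColor φ j' ≡ y)
    {x z : Fin 3} (x≢y : x ≢ y) (y≢z : y ≢ z) (x≢z : x ≢ z)
    (cᵢ≡x : spokeColor φ i ≡ x) (2≤ℓ : 2 ≤ ℓ)
    where
    open Window i (subst (_< suc k) j≡i+ℓ (toℕ<n j)) public
    open Alternation r c 2≤ℓ r≢c r≢c-suc r≢r-suc x≢y y≢z x≢z
                     (trans (c≡spokeColor i (sym (+-identityʳ (toℕ i)))) cᵢ≡x)
                     (c≡inner {j} j≡i+ℓ inner) public

lemma5 : (m : ℕ) → 3 ≤ m → (φ : Coloring m) → Proper φ →
    ¬ (Σ (Fin m) λ i → Σ (Fin m) λ k → Σ ℕ λ ℓ → Σ (Fin 3) λ x → Σ (Fin 3) λ y → Σ (Fin 3) λ z →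
        toℕ k ≡ toℕ i + ℓ × x ≢ y × y ≢ z × x ≢ z ×
        (∀ (j : Fin m) → toℕ i < toℕ j → toℕ j < toℕ k → spokeColor φ j ≡ y) ×
        ((Even ℓ × 2 ≤ ℓ × spokeColor φ i ≡ x × spokeColor φ k ≡ x)
         ⊎ (Odd ℓ × 3 ≤ ℓ × spokeColor φ i ≡ x × spokeColor φ k ≡ z)))
lemma5 (suc _) _ φ proper (i , j , ℓ , x , y , z , j≡i+ℓ , x≢y , y≢z , x≢z , inner ,
                           inj₁ (ℓ-even , 2≤ℓ , cᵢ≡x , cⱼ≡x)) =
  even-block-impossible ℓ-even (trans (c≡spokeColor j j≡i+ℓ) cⱼ≡x)
  where open Wheel proper
        open Block j≡i+ℓ inner x≢y y≢z x≢z cᵢ≡x 2≤ℓ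
lemma5 (suc _) _ φ proper (i , j , ℓ , x , y , z , j≡i+ℓ , x≢y , y≢z , x≢z , inner ,
                           inj₂ (ℓ-odd , 3≤ℓ , cᵢ≡x , cⱼ≡z)) =
  odd-block-impossible ℓ-odd (trans (c≡spokeColor j j≡i+ℓ) cⱼ≡z)
  where open Wheel proper
        open Block j≡i+ℓ inner x≢y y≢z x≢z cᵢ≡x (≤-trans (n≤1+n 2) 3≤ℓ)
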